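{- (i) Let $n$ be odd and $\frac{n+1}{2}\le p\le n-2$. Put $r=\sum_{i=0}^{p-\frac{n-1}{2}}\binom{n}{i}$ and $s=\binom{p}{p-\frac{n-1}{2}}$. Then $|C^p(\mathcal{I}_{r-s})|=2^{n-1}-(r-2s)$. (ii) Let $n$ be even and $\frac{n}{2}+1\le p\le n-2$. Put $r'=\sum_{i=0}^{p-\frac{n}{2}}\binom{n}{i}+\binom{n-1}{p-\frac{n}{2}}$ and $s'=\binom{p-1}{p-\frac{n}{2}}$. Then $|C^p(\mathcal{I}_{r'-s'})|=2^{n-1}-(r'-2s')$.
   Context: $[n]=\{1,\dots,n\}$ and $2^{[n]}$ is its power set. The simplicial ordering on $2^{[n]}$: for distinct $x,y\in 2^{[n]}$, $x<y$ if either $|x|<|y|$, or $|x|=|y|$ and $\min(x\triangle y)\in x$. For $0\le m\le 2^n$, $\mathcal{I}_m$ denotes the set of the first $m$ elements of $2^{[n]}$ in the simplicial ordering. For $A\subseteq 2^{[n]}$, $C^p[A]=\{y\in 2^{[n]}: |x\triangle y|\le p \text{ for every } x\in A\}$ and $C^p(A)=C^p[A]\setminus A$. -}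

module Defs where

open import Data.Nat using (ℕ; zero; suc; _+_; _<ᵇ_; _≡ᵇ_; _≤ᵇ_)
open import Data.Bool using (Bool; true; false; _∧_; _∨_; not; if_then_else_)
open import Data.Vec using (Vec; []; _∷_)
open import Data.List using (List; []; _∷_; _++_; map)
open import Data.Bool.Properties using () renaming (_≟_ to _≟ᵇ_)
open import Relation.Nullary.Decidable using (does)

countB : ∀ {A : Set} → (A → Bool) → List A → ℕ
countB f [] = 0
countB f (a ∷ as) = if f a then suc (countB f as) else countB f as

allB : ∀ {A : Set} → (A → Bool) → List A → Bool
allB f [] = true
allB f (a ∷ as) = f a ∧ allB f as

-- A subset of [n] = {1,…,n} is its characteristic vector: position i (0-based)
-- stands for the element i+1.
Sub : ℕ → Set
Sub n = Vec Bool n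

allSubsets : (n : ℕ) → List (Sub n)
allSubsets zero = [] ∷ []
allSubsets (suc n) = map (true ∷_) (allSubsets n) ++ map (false ∷_) (allSubsets n)

card : ∀ {n} → Sub n → ℕ
card [] = 0
card (true ∷ x) = suc (card x)
card (false ∷ x) = card x

symDiffCard : ∀ {n} → Sub n → Sub n → ℕ
symDiffCard [] [] = 0
symDiffCard (a ∷ x) (b ∷ y) =
  if does (a ≟ᵇ b) then symDiffCard x y else suc (symDiffCard x y)

-- "min (x △ y) ∈ x": the least element where x and y differ lies in x
-- (false if x = y)
minSymDiffInFst : ∀ {n} → Sub n → Sub n → Bool
minSymDiffInFst [] [] = false
minSymDiffInFst (a ∷ x) (b ∷ y) =
  if does (a ≟ᵇ b) then minSymDiffInFst x y else a

simpLt : ∀ {n} → Sub n → Sub n → Bool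
simpLt x y = (card x <ᵇ card y) ∨ ((card x ≡ᵇ card y) ∧ minSymDiffInFst x y)

rank : ∀ {n} → Sub n → ℕ
rank {n} y = countB (λ x → simpLt x y) (allSubsets n)

-- membership in I_m, the set of the first m elements in the simplicial ordering
inI : ∀ {n} → ℕ → Sub n → Bool
inI m y = rank y <ᵇ m

-- membership in C^p(I_m) = C^p[I_m] \ I_m
inCpI : ∀ {n} → ℕ → ℕ → Sub n → Bool
inCpI {n} p m y =
  not (inI m y) ∧ allB (λ x → not (inI m x) ∨ (symDiffCard x y ≤ᵇ p)) (allSubsets n)

cardCpI : ℕ → ℕ → ℕ → ℕ
cardCpI n p m = countB (inCpI p m) (allSubsets n)

sumTo : (ℕ → ℕ) → ℕ → ℕ
sumTo f zero = f 0
sumTo f (suc d) = sumTo f d + f (suc d)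

module Submission where

-- Write d = p − ⌊n/2⌋ and q = n − p. The simplicial order lists sets by size and, within a size, puts
-- first the sets containing smaller elements, so I_{r−s} consists of the sets of size < d and the d-sets
-- meeting [q] (for even n: the sets of size ≤ d and the (d+1)-sets containing 1 and meeting
-- {2, …, q+1}). Let L = p + 1 − d (resp. p − d). Every set of size < L is within distance p of all of
-- I_{r−s}; a set of size > L is farther than p from some member of I_{r−s} disjoint from it; and a
-- set of size L lies in C^p exactly when it meets every largest member of I_{r−s}, i.e. contains [q]
-- (for even n: contains 1 or {2, …, q+1}), which happens for s of them (plus those containing 1).
-- So |C^p| + |I_{r−s}| counts the sets of size < L plus these, and complementation y ↦ [n] ∖ y shows
-- that the sets of size < L (for even n, with the half of layer L containing 1) number 2^{n−1}.

open import Defs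
open import Data.Nat using (ℕ; zero; suc; _+_; _*_; _∸_; _^_; _≤_; _<_; z≤n; s≤s; _<ᵇ_; _≡ᵇ_; _≤ᵇ_)
open import Data.Nat.Properties
open import Data.Nat.Combinatorics using (_C_; nCk+nC[k+1]≡[n+1]C[k+1]; nCk≡nC[n∸k])
open import Data.Nat.Tactic.RingSolver using (solve-∀)
open import Data.Bool using (Bool; true; false; _∧_; _∨_; not)
open import Data.Bool.Properties using (∧-identityʳ; ∧-zeroʳ)
open import Data.Vec using (_∷_; [])
open import Data.List using ([]; _∷_; _++_; map)
open import Data.Product using (_×_; _,_; proj₁; proj₂; ∃₂)
open import Data.Sum using (_⊎_; inj₁; inj₂)
open import Data.Empty using (⊥-elim)
open import Function using (_∘_)
open import Relation.Binary using (tri<; tri≈; tri>)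
open import Relation.Binary.PropositionalEquality
open import Relation.Nullary using (¬_; Reflects; ofʸ; ofⁿ; yes; no)
open import Relation.Nullary.Reflects using (fromEquivalence)

module _ {P : Set} where

  reflects-true : ∀ {b} → Reflects P b → P → b ≡ true
  reflects-true (ofʸ _) _ = refl
  reflects-true (ofⁿ ¬p) p = ⊥-elim (¬p p)

  reflects-false : ∀ {b} → Reflects P b → ¬ P → b ≡ false
  reflects-false (ofʸ p) ¬p = ⊥-elim (¬p p)
  reflects-false (ofⁿ _) _ = refl

  reflects-true⁻¹ : ∀ {b} → Reflects P b → b ≡ true → P
  reflects-true⁻¹ (ofʸ p) _ = p

  reflects-false⁻¹ : ∀ {b} → Reflects P b → b ≡ false → ¬ P
  reflects-false⁻¹ (ofⁿ ¬p) _ = ¬p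

≡ᵇ-reflects-≡ : ∀ m n → Reflects (m ≡ n) (m ≡ᵇ n)
≡ᵇ-reflects-≡ m n = fromEquivalence (≡ᵇ⇒≡ m n) (≡⇒≡ᵇ m n)

<ᵇ-true : ∀ {m n} → m < n → (m <ᵇ n) ≡ true
<ᵇ-true = reflects-true (<ᵇ-reflects-< _ _)

<ᵇ-false : ∀ {m n} → n ≤ m → (m <ᵇ n) ≡ false
<ᵇ-false n≤m = reflects-false (<ᵇ-reflects-< _ _) (≤⇒≯ n≤m)

<ᵇ-true⁻¹ : ∀ {m n} → (m <ᵇ n) ≡ true → m < n
<ᵇ-true⁻¹ = reflects-true⁻¹ (<ᵇ-reflects-< _ _)

<ᵇ-false⁻¹ : ∀ {m n} → (m <ᵇ n) ≡ false → n ≤ m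
<ᵇ-false⁻¹ e = ≮⇒≥ (reflects-false⁻¹ (<ᵇ-reflects-< _ _) e)

≤ᵇ-true : ∀ {m n} → m ≤ n → (m ≤ᵇ n) ≡ true
≤ᵇ-true = reflects-true (≤ᵇ-reflects-≤ _ _)

≤ᵇ-false : ∀ {m n} → n < m → (m ≤ᵇ n) ≡ false
≤ᵇ-false n<m = reflects-false (≤ᵇ-reflects-≤ _ _) (<⇒≱ n<m)

≡ᵇ-true : ∀ {m n} → m ≡ n → (m ≡ᵇ n) ≡ true
≡ᵇ-true = reflects-true (≡ᵇ-reflects-≡ _ _)

≡ᵇ-false : ∀ {m n} → m ≢ n → (m ≡ᵇ n) ≡ false
≡ᵇ-false = reflects-false (≡ᵇ-reflects-≡ _ _)

≡ᵇ-true⁻¹ : ∀ {m n} → (m ≡ᵇ n) ≡ true → m ≡ n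
≡ᵇ-true⁻¹ = reflects-true⁻¹ (≡ᵇ-reflects-≡ _ _)

∧-true⁻¹ : ∀ {a b} → a ∧ b ≡ true → a ≡ true × b ≡ true
∧-true⁻¹ {true} e = refl , e

∨-true⁻¹ : ∀ {a b} → a ∨ b ≡ true → a ≡ true ⊎ b ≡ true
∨-true⁻¹ {true} _ = inj₁ refl
∨-true⁻¹ {false} e = inj₂ e

∨-false⁻¹ : ∀ {a b} → a ∨ b ≡ false → a ≡ false × b ≡ false
∨-false⁻¹ {false} e = refl , e

true≢false : ∀ {b} → b ≡ true → b ≢ false
true≢false refl ()

not-<ᵇ : ∀ m n → not (m <ᵇ n) ≡ (n ≤ᵇ m)
not-<ᵇ m zero = refl
not-<ᵇ zero (suc n) = refl
not-<ᵇ (suc m) (suc n) = trans (not-<ᵇ m n) (≤ᵇ≡<ᵇsuc n m)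
  where
  ≤ᵇ≡<ᵇsuc : ∀ n m → (n ≤ᵇ m) ≡ (n <ᵇ suc m)
  ≤ᵇ≡<ᵇsuc zero m = refl
  ≤ᵇ≡<ᵇsuc (suc n) m = refl

≮ᵇ∧≡ᵇ : ∀ m n → not (m <ᵇ n) ∧ (m ≡ᵇ n) ≡ (m ≡ᵇ n)
≮ᵇ∧≡ᵇ zero zero = refl
≮ᵇ∧≡ᵇ zero (suc n) = refl
≮ᵇ∧≡ᵇ (suc m) zero = refl
≮ᵇ∧≡ᵇ (suc m) (suc n) = ≮ᵇ∧≡ᵇ m n

≮ᵇ∧≢ᵇ : ∀ m n → not (m <ᵇ n) ∧ not (m ≡ᵇ n) ≡ (n <ᵇ m)
≮ᵇ∧≢ᵇ zero zero = refl
≮ᵇ∧≢ᵇ zero (suc n) = refl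
≮ᵇ∧≢ᵇ (suc m) zero = refl
≮ᵇ∧≢ᵇ (suc m) (suc n) = ≮ᵇ∧≢ᵇ m n

<ᵇsuc∧<ᵇ : ∀ m n → (m <ᵇ suc n) ∧ (m <ᵇ n) ≡ (m <ᵇ n)
<ᵇsuc∧<ᵇ zero zero = refl
<ᵇsuc∧<ᵇ zero (suc n) = refl
<ᵇsuc∧<ᵇ (suc m) zero = ∧-zeroʳ (m <ᵇ 0)
<ᵇsuc∧<ᵇ (suc m) (suc n) = <ᵇsuc∧<ᵇ m n

<ᵇsuc∧≮ᵇ : ∀ m n → (m <ᵇ suc n) ∧ not (m <ᵇ n) ≡ (m ≡ᵇ n)
<ᵇsuc∧≮ᵇ zero zero = refl
<ᵇsuc∧≮ᵇ zero (suc n) = refl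
<ᵇsuc∧≮ᵇ (suc m) zero = ∧-identityʳ _
<ᵇsuc∧≮ᵇ (suc m) (suc n) = <ᵇsuc∧≮ᵇ m n

-- Counting subsets

module _ {A : Set} where

  countB-++ : ∀ (f : A → Bool) xs ys → countB f (xs ++ ys) ≡ countB f xs + countB f ys
  countB-++ f [] ys = refl
  countB-++ f (x ∷ xs) ys with f x
  ... | true = cong suc (countB-++ f xs ys)
  ... | false = countB-++ f xs ys

  countB-cong : ∀ {f g : A → Bool} → (∀ x → f x ≡ g x) → ∀ xs → countB f xs ≡ countB g xs
  countB-cong e [] = refl
  countB-cong {g = g} e (x ∷ xs) rewrite e x with g x
  ... | true = cong suc (countB-cong e xs)
  ... | false = countB-cong e xs

  countB-none : ∀ {f : A → Bool} → (∀ x → f x ≡ false) → ∀ xs → countB f xs ≡ 0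
  countB-none e [] = refl
  countB-none e (x ∷ xs) rewrite e x = countB-none e xs

  countB-split : ∀ (f g : A → Bool) xs →
                 countB f xs ≡ countB (λ x → f x ∧ g x) xs + countB (λ x → f x ∧ not (g x)) xs
  countB-split f g [] = refl
  countB-split f g (x ∷ xs) with f x | g x
  ... | true  | true  = cong suc (countB-split f g xs)
  ... | true  | false = trans (cong suc (countB-split f g xs)) (sym (+-suc _ _))
  ... | false | _     = countB-split f g xs

  countB-∨-disjoint : ∀ (f g : A → Bool) → (∀ x → f x ∧ g x ≡ false) →
                      ∀ xs → countB (λ x → f x ∨ g x) xs ≡ countB f xs + countB g xs
  countB-∨-disjoint f g disj [] = refl
  countB-∨-disjoint f g disj (x ∷ xs) with f x | g x | disj x
  ... | true  | false | _ = cong suc (countB-∨-disjoint f g disj xs)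
  ... | false | true  | _ = trans (cong suc (countB-∨-disjoint f g disj xs)) (sym (+-suc _ _))
  ... | false | false | _ = countB-∨-disjoint f g disj xs

  countB-mono : ∀ {f g : A → Bool} → (∀ x → f x ≡ true → g x ≡ true) →
                ∀ xs → countB f xs ≤ countB g xs
  countB-mono f⇒g [] = z≤n
  countB-mono {f} {g} f⇒g (x ∷ xs) with f x in fx | g x in gx
  ... | true  | true  = s≤s (countB-mono f⇒g xs)
  ... | true  | false = ⊥-elim (true≢false (f⇒g x fx) gx)
  ... | false | true  = m≤n⇒m≤1+n (countB-mono f⇒g xs)
  ... | false | false = countB-mono f⇒g xs

countB-map : ∀ {A B : Set} (f : B → Bool) (g : A → B) xs → countB f (map g xs) ≡ countB (f ∘ g) xs
countB-map f g [] = refl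
countB-map f g (x ∷ xs) with f (g x)
... | true = cong suc (countB-map f g xs)
... | false = countB-map f g xs

count : ∀ n → (Sub n → Bool) → ℕ
count n f = countB f (allSubsets n)

count-∷ : ∀ {n} (f : Sub (suc n) → Bool) →
          count (suc n) f ≡ count n (f ∘ (true ∷_)) + count n (f ∘ (false ∷_))
count-∷ {n} f = trans (countB-++ f (map (true ∷_) (allSubsets n)) (map (false ∷_) (allSubsets n)))
  (cong₂ _+_ (countB-map f (true ∷_) (allSubsets n)) (countB-map f (false ∷_) (allSubsets n)))

module _ {n : ℕ} where

  count-cong : ∀ {f g : Sub n → Bool} → (∀ y → f y ≡ g y) → count n f ≡ count n g
  count-cong e = countB-cong e (allSubsets n)

  count-none : ∀ {f : Sub n → Bool} → (∀ y → f y ≡ false) → count n f ≡ 0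
  count-none e = countB-none e (allSubsets n)

  count-split : ∀ (f g : Sub n → Bool) →
                count n f ≡ count n (λ y → f y ∧ g y) + count n (λ y → f y ∧ not (g y))
  count-split f g = countB-split f g (allSubsets n)

  count-∨-disjoint : ∀ (f g : Sub n → Bool) → (∀ y → f y ∧ g y ≡ false) →
                     count n (λ y → f y ∨ g y) ≡ count n f + count n g
  count-∨-disjoint f g disj = countB-∨-disjoint f g disj (allSubsets n)

  count-mono : ∀ {f g : Sub n → Bool} → (∀ y → f y ≡ true → g y ≡ true) → count n f ≤ count n g
  count-mono f⇒g = countB-mono f⇒g (allSubsets n)

count-mono-< : ∀ {n} {f g : Sub n → Bool} → (∀ y → f y ≡ true → g y ≡ true) →
               ∀ y → f y ≡ false → g y ≡ true → count n f < count n g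
count-mono-< {zero} f⇒g [] fy gy rewrite fy | gy = s≤s z≤n
count-mono-< {suc n} {f} {g} f⇒g (true ∷ y) fy gy rewrite count-∷ f | count-∷ g =
  +-mono-<-≤ (count-mono-< (f⇒g ∘ (true ∷_)) y fy gy) (count-mono (f⇒g ∘ (false ∷_)))
count-mono-< {suc n} {f} {g} f⇒g (false ∷ y) fy gy rewrite count-∷ f | count-∷ g =
  +-mono-≤-< (count-mono (f⇒g ∘ (true ∷_))) (count-mono-< (f⇒g ∘ (false ∷_)) y fy gy)

count-true : ∀ n → count n (λ _ → true) ≡ 2 ^ n
count-true zero = refl
count-true (suc n) = begin
  count (suc n) (λ _ → true)                   ≡⟨ count-∷ {n} (λ _ → true) ⟩
  count n (λ _ → true) + count n (λ _ → true)  ≡⟨ cong₂ _+_ (count-true n) (count-true n) ⟩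
  2 ^ n + 2 ^ n                                ≡⟨ cong (2 ^ n +_) (sym (+-identityʳ (2 ^ n))) ⟩
  2 ^ suc n                                    ∎
  where open ≡-Reasoning

count-card≡ : ∀ n i → count n (λ y → card y ≡ᵇ i) ≡ n C i
count-card≡ zero zero = refl
count-card≡ zero (suc i) = refl
count-card≡ (suc n) zero = trans (count-∷ {n} (λ y → card y ≡ᵇ 0))
  (cong₂ _+_ (count-none {n} (λ _ → refl)) (count-card≡ n 0))
count-card≡ (suc n) (suc i) = begin
  count (suc n) (λ y → card y ≡ᵇ suc i)  ≡⟨ count-∷ {n} (λ y → card y ≡ᵇ suc i) ⟩
  count n (λ y → card y ≡ᵇ i) + count n (λ y → card y ≡ᵇ suc i)
                                        ≡⟨ cong₂ _+_ (count-card≡ n i) (count-card≡ n (suc i)) ⟩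
  n C i + n C suc i                     ≡⟨ nCk+nC[k+1]≡[n+1]C[k+1] n i ⟩
  suc n C suc i                         ∎
  where open ≡-Reasoning

count-card< : ∀ n u → count n (λ y → card y <ᵇ suc u) ≡ sumTo (n C_) u
count-card< n zero = trans (count-cong {n} (λ y → <1 (card y))) (count-card≡ n 0)
  where
  <1 : ∀ c → (c <ᵇ 1) ≡ (c ≡ᵇ 0)
  <1 zero = refl
  <1 (suc c) = refl
count-card< n (suc u) = begin
  count n (λ y → card y <ᵇ suc (suc u))
    ≡⟨ count-split {n} (λ y → card y <ᵇ suc (suc u)) (λ y → card y <ᵇ suc u) ⟩
  count n (λ y → (card y <ᵇ suc (suc u)) ∧ (card y <ᵇ suc u))
    + count n (λ y → (card y <ᵇ suc (suc u)) ∧ not (card y <ᵇ suc u))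
    ≡⟨ cong₂ _+_ (count-cong {n} (λ y → <ᵇsuc∧<ᵇ (card y) (suc u)))
                 (count-cong {n} (λ y → <ᵇsuc∧≮ᵇ (card y) (suc u))) ⟩
  count n (λ y → card y <ᵇ suc u) + count n (λ y → card y ≡ᵇ suc u)
    ≡⟨ cong₂ _+_ (count-card< n u) (count-card≡ n (suc u)) ⟩
  sumTo (n C_) (suc u) ∎
  where open ≡-Reasoning

-- Complementation

complement : ∀ {n} → Sub n → Sub n
complement [] = []
complement (b ∷ y) = not b ∷ complement y

card-complement : ∀ {n} (y : Sub n) → card (complement y) + card y ≡ n
card-complement [] = refl
card-complement (true ∷ y) = trans (+-suc _ _) (cong suc (card-complement y))
card-complement (false ∷ y) = cong suc (card-complement y)

count-complement : ∀ {n} (f : Sub n → Bool) → count n f ≡ count n (f ∘ complement)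
count-complement {zero} f = refl
count-complement {suc n} f = begin
  count (suc n) f                                    ≡⟨ count-∷ f ⟩
  count n (f ∘ (true ∷_)) + count n (f ∘ (false ∷_)) ≡⟨ +-comm (count n (f ∘ (true ∷_))) _ ⟩
  count n (f ∘ (false ∷_)) + count n (f ∘ (true ∷_))
    ≡⟨ cong₂ _+_ (count-complement (f ∘ (false ∷_))) (count-complement (f ∘ (true ∷_))) ⟩
  count n (f ∘ (false ∷_) ∘ complement) + count n (f ∘ (true ∷_) ∘ complement)
    ≡⟨ sym (count-∷ (f ∘ complement)) ⟩
  count (suc n) (f ∘ complement)                     ∎
  where open ≡-Reasoning

count-card-reflect : ∀ {n} (f g : ℕ → Bool) → (∀ a c → a + c ≡ n → f a ≡ g c) →
                     count n (f ∘ card) ≡ count n (g ∘ card)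
count-card-reflect {n} f g fg =
  trans (count-complement {n} (f ∘ card)) (count-cong {n} (λ y → fg _ _ (card-complement y)))

count-card<-reflect : ∀ {n} a b → a + b ≡ n → count n (λ y → card y <ᵇ a) ≡ count n (λ y → b <ᵇ card y)
count-card<-reflect a b a+b≡n = count-card-reflect (_<ᵇ a) (b <ᵇ_) reflect
  where
  transfer : ∀ {u v a b} → u + v ≡ a + b → u < a → b < v
  transfer e u<a = ≰⇒> (λ v≤b → <-irrefl e (+-mono-<-≤ u<a v≤b))

  reflect : ∀ u v → u + v ≡ _ → (u <ᵇ a) ≡ (b <ᵇ v)
  reflect u v e with u <? a
  ... | yes u<a = trans (<ᵇ-true u<a) (sym (<ᵇ-true (transfer (trans e (sym a+b≡n)) u<a)))
  ... | no u≮a = trans (<ᵇ-false (≮⇒≥ u≮a)) (sym (<ᵇ-false (≮⇒≥ (u≮a ∘ transfer e′))))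
    where
    e′ : b + a ≡ v + u
    e′ = trans (+-comm b a) (trans a+b≡n (trans (sym e) (+-comm u v)))

count-lowerHalf-odd : ∀ {n} k → n ≡ suc (k + k) → count n (λ y → card y <ᵇ suc k) ≡ 2 ^ (n ∸ 1)
count-lowerHalf-odd {n} k refl = *-cancelˡ-≡ _ _ 2 (begin
  2 * L                                      ≡⟨ cong (L +_) (+-identityʳ L) ⟩
  L + L                                      ≡⟨ cong (L +_) (count-card<-reflect (suc k) k refl) ⟩
  L + count n (λ y → k <ᵇ card y)            ≡⟨ cong (L +_) (count-cong {n} (λ y → sym (not-<ᵇ (card y) (suc k)))) ⟩
  L + count n (λ y → not (card y <ᵇ suc k))  ≡⟨ sym (count-split {n} (λ _ → true) (λ y → card y <ᵇ suc k)) ⟩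
  count n (λ _ → true)                       ≡⟨ count-true n ⟩
  2 ^ n                                      ∎)
  where
  open ≡-Reasoning
  L = count n (λ y → card y <ᵇ suc k)

count-by-size : ∀ n a → count n (λ _ → true)
                        ≡ count n (λ y → card y <ᵇ a) + (count n (λ y → card y ≡ᵇ a) + count n (λ y → a <ᵇ card y))
count-by-size n a = begin
  count n (λ _ → true)
    ≡⟨ count-split {n} (λ _ → true) (λ y → card y <ᵇ a) ⟩
  count n (λ y → card y <ᵇ a) + count n (λ y → not (card y <ᵇ a))
    ≡⟨ cong (count n (λ y → card y <ᵇ a) +_) (count-split {n} (λ y → not (card y <ᵇ a)) (λ y → card y ≡ᵇ a)) ⟩
  count n (λ y → card y <ᵇ a) + (count n (λ y → not (card y <ᵇ a) ∧ (card y ≡ᵇ a))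
                                 + count n (λ y → not (card y <ᵇ a) ∧ not (card y ≡ᵇ a)))
    ≡⟨ cong (λ c → count n (λ y → card y <ᵇ a) + c)
            (cong₂ _+_ (count-cong {n} (λ y → ≮ᵇ∧≡ᵇ (card y) a)) (count-cong {n} (λ y → ≮ᵇ∧≢ᵇ (card y) a))) ⟩
  count n (λ y → card y <ᵇ a) + (count n (λ y → card y ≡ᵇ a) + count n (λ y → a <ᵇ card y)) ∎
  where open ≡-Reasoning

count-lowerHalf-even : ∀ {m} j → m ≡ j + suc j → count (suc m) (λ y → card y <ᵇ suc j) + m C j ≡ 2 ^ m
count-lowerHalf-even {m} j refl = *-cancelˡ-≡ _ _ 2 (begin
  2 * (L + m C j)                ≡⟨ double L (m C j) ⟩
  L + ((m C j + m C j) + L)      ≡⟨ cong (λ c → L + ((m C j + c) + L)) (sym middle-symmetric) ⟩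
  L + ((m C j + m C suc j) + L)  ≡⟨ cong (λ c → L + (c + L)) (nCk+nC[k+1]≡[n+1]C[k+1] m j) ⟩
  L + (suc m C suc j + L)        ≡⟨ cong₂ (λ c d → L + (c + d)) (sym (count-card≡ (suc m) (suc j)))
                                                                (count-card<-reflect (suc j) (suc j) refl) ⟩
  L + (count (suc m) (λ y → card y ≡ᵇ suc j) + count (suc m) (λ y → suc j <ᵇ card y))
                                 ≡⟨ sym (count-by-size (suc m) (suc j)) ⟩
  count (suc m) (λ _ → true)     ≡⟨ count-true (suc m) ⟩
  2 ^ suc m                      ∎)
  where
  open ≡-Reasoning
  L = count (suc m) (λ y → card y <ᵇ suc j)

  double : ∀ a b → 2 * (a + b) ≡ a + ((b + b) + a)
  double = solve-∀

  middle-symmetric : m C suc j ≡ m C j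
  middle-symmetric = trans (nCk≡nC[n∸k] (m≤n+m (suc j) j)) (cong (m C_) (m+n∸n≡m j (suc j)))

-- Intersections, symmetric differences and prefixes

interCard : ∀ {n} → Sub n → Sub n → ℕ
interCard [] [] = 0
interCard (true ∷ x) (true ∷ y) = suc (interCard x y)
interCard (true ∷ x) (false ∷ y) = interCard x y
interCard (false ∷ x) (_ ∷ y) = interCard x y

symDiffCard+2*interCard : ∀ {n} (x y : Sub n) → symDiffCard x y + 2 * interCard x y ≡ card x + card y
symDiffCard+2*interCard [] [] = refl
symDiffCard+2*interCard (true ∷ x) (true ∷ y) = begin
  symDiffCard x y + 2 * suc (interCard x y)  ≡⟨ shift (symDiffCard x y) (interCard x y) ⟩
  2 + (symDiffCard x y + 2 * interCard x y)  ≡⟨ cong (2 +_) (symDiffCard+2*interCard x y) ⟩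
  2 + (card x + card y)                      ≡⟨ cong suc (sym (+-suc (card x) (card y))) ⟩
  suc (card x) + suc (card y)                ∎
  where
  open ≡-Reasoning
  shift : ∀ d i → d + 2 * suc i ≡ 2 + (d + 2 * i)
  shift = solve-∀
symDiffCard+2*interCard (true ∷ x) (false ∷ y) = cong suc (symDiffCard+2*interCard x y)
symDiffCard+2*interCard (false ∷ x) (true ∷ y) =
  trans (cong suc (symDiffCard+2*interCard x y)) (sym (+-suc (card x) (card y)))
symDiffCard+2*interCard (false ∷ x) (false ∷ y) = symDiffCard+2*interCard x y

symDiffCard≤card+card : ∀ {n} (x y : Sub n) → symDiffCard x y ≤ card x + card y
symDiffCard≤card+card x y = ≤-trans (m≤m+n _ _) (≤-reflexive (symDiffCard+2*interCard x y))

symDiffCard-shared : ∀ {n} (x y : Sub n) → 1 ≤ interCard x y → 2 + symDiffCard x y ≤ card x + card y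
symDiffCard-shared x y 1≤i = begin
  2 + symDiffCard x y                  ≡⟨ +-comm 2 _ ⟩
  symDiffCard x y + 2 * 1              ≤⟨ +-monoʳ-≤ (symDiffCard x y) (*-monoʳ-≤ 2 1≤i) ⟩
  symDiffCard x y + 2 * interCard x y  ≡⟨ symDiffCard+2*interCard x y ⟩
  card x + card y                      ∎
  where open ≤-Reasoning

symDiffCard-disjoint : ∀ {n} (x y : Sub n) → interCard x y ≡ 0 → symDiffCard x y ≡ card x + card y
symDiffCard-disjoint x y i≡0 = begin
  symDiffCard x y                      ≡⟨ sym (+-identityʳ _) ⟩
  symDiffCard x y + 2 * 0              ≡⟨ cong (λ i → symDiffCard x y + 2 * i) (sym i≡0) ⟩
  symDiffCard x y + 2 * interCard x y  ≡⟨ symDiffCard+2*interCard x y ⟩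
  card x + card y                      ∎
  where open ≡-Reasoning

meetsPrefix : ∀ {n} → ℕ → Sub n → Bool
meetsPrefix zero y = false
meetsPrefix (suc q) [] = false
meetsPrefix (suc q) (b ∷ y) = b ∨ meetsPrefix q y

containsPrefix : ∀ {n} → ℕ → Sub n → Bool
containsPrefix zero y = true
containsPrefix (suc q) [] = true
containsPrefix (suc q) (b ∷ y) = b ∧ containsPrefix q y

interCard-prefix : ∀ {n} q (x y : Sub n) → meetsPrefix q x ≡ true → containsPrefix q y ≡ true →
                   1 ≤ interCard x y
interCard-prefix (suc q) (true ∷ x) (true ∷ y) _ _ = s≤s z≤n
interCard-prefix (suc q) (false ∷ x) (true ∷ y) mx cy = interCard-prefix q x y mx cy

pickOutside : ∀ {n} → ℕ → Sub n → Sub n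
pickOutside j [] = []
pickOutside zero (b ∷ y) = false ∷ pickOutside zero y
pickOutside (suc j) (true ∷ y) = false ∷ pickOutside (suc j) y
pickOutside (suc j) (false ∷ y) = true ∷ pickOutside j y

interCard-pickOutside : ∀ {n} j (y : Sub n) → interCard (pickOutside j y) y ≡ 0
interCard-pickOutside j [] = refl
interCard-pickOutside zero (b ∷ y) = interCard-pickOutside zero y
interCard-pickOutside (suc j) (true ∷ y) = interCard-pickOutside (suc j) y
interCard-pickOutside (suc j) (false ∷ y) = interCard-pickOutside j y

card-pickOutside-≤ : ∀ {n} j (y : Sub n) → card (pickOutside j y) ≤ j
card-pickOutside-≤ j [] = z≤n
card-pickOutside-≤ zero (b ∷ y) = card-pickOutside-≤ zero y
card-pickOutside-≤ (suc j) (true ∷ y) = card-pickOutside-≤ (suc j) y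
card-pickOutside-≤ (suc j) (false ∷ y) = s≤s (card-pickOutside-≤ j y)

card-pickOutside : ∀ {n} j (y : Sub n) → card (pickOutside j y) ≡ j ⊎ card (pickOutside j y) + card y ≡ n
card-pickOutside zero y = inj₁ (n≤0⇒n≡0 (card-pickOutside-≤ zero y))
card-pickOutside (suc j) [] = inj₂ refl
card-pickOutside (suc j) (true ∷ y) with card-pickOutside (suc j) y
... | inj₁ e = inj₁ e
... | inj₂ e = inj₂ (trans (+-suc _ _) (cong suc e))
card-pickOutside (suc j) (false ∷ y) with card-pickOutside j y
... | inj₁ e = inj₁ (cong suc e)
... | inj₂ e = inj₂ (cong suc e)

card-pickOutside-room : ∀ {n} j (y : Sub n) → j + card y ≤ n → card (pickOutside j y) ≡ j
card-pickOutside-room {n} j y room with card-pickOutside j y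
... | inj₁ e = e
... | inj₂ e = ≤-antisym (card-pickOutside-≤ j y)
                 (+-cancelʳ-≤ (card y) j _ (≤-trans room (≤-reflexive (sym e))))

meetsPrefix-pickOutside : ∀ {n} q j (y : Sub n) → containsPrefix q y ≡ false →
                          meetsPrefix q (pickOutside (suc j) y) ≡ true
meetsPrefix-pickOutside (suc q) j (true ∷ y) c = meetsPrefix-pickOutside q j y c
meetsPrefix-pickOutside (suc q) j (false ∷ y) c = refl

count-avoidingPrefix : ∀ q m i → count (q + m) (λ y → (card y ≡ᵇ i) ∧ not (meetsPrefix q y)) ≡ m C i
count-avoidingPrefix zero m i = trans (count-cong {m} (λ y → ∧-identityʳ _)) (count-card≡ m i)
count-avoidingPrefix (suc q) m i =
  trans (count-∷ {q + m} (λ y → (card y ≡ᵇ i) ∧ not (meetsPrefix (suc q) y)))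
        (cong₂ _+_ (count-none {q + m} (λ y → ∧-zeroʳ _)) (count-avoidingPrefix q m i))

count-containingPrefix : ∀ q m i → count (q + m) (λ y → (card y ≡ᵇ q + i) ∧ containsPrefix q y) ≡ m C i
count-containingPrefix zero m i = trans (count-cong {m} (λ y → ∧-identityʳ _)) (count-card≡ m i)
count-containingPrefix (suc q) m i =
  trans (count-∷ {q + m} (λ y → (card y ≡ᵇ suc q + i) ∧ containsPrefix (suc q) y))
        (trans (cong₂ _+_ (count-containingPrefix q m i) (count-none {q + m} (λ y → ∧-zeroʳ _)))
               (+-identityʳ _))

count-meetingPrefix : ∀ q m i → count (q + m) (λ y → (card y ≡ᵇ i) ∧ meetsPrefix q y) + m C i ≡ (q + m) C i
count-meetingPrefix q m i = begin
  count (q + m) (λ y → (card y ≡ᵇ i) ∧ meetsPrefix q y) + m C i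
    ≡⟨ cong (count (q + m) (λ y → (card y ≡ᵇ i) ∧ meetsPrefix q y) +_) (sym (count-avoidingPrefix q m i)) ⟩
  count (q + m) (λ y → (card y ≡ᵇ i) ∧ meetsPrefix q y)
    + count (q + m) (λ y → (card y ≡ᵇ i) ∧ not (meetsPrefix q y))
    ≡⟨ sym (count-split {q + m} (λ y → card y ≡ᵇ i) (meetsPrefix q)) ⟩
  count (q + m) (λ y → card y ≡ᵇ i)
    ≡⟨ count-card≡ (q + m) i ⟩
  (q + m) C i ∎
  where open ≡-Reasoning

-- Initial segments of the simplicial order

minSymDiffInFst-irrefl : ∀ {n} (x : Sub n) → minSymDiffInFst x x ≡ false
minSymDiffInFst-irrefl [] = refl
minSymDiffInFst-irrefl (true ∷ x) = minSymDiffInFst-irrefl x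
minSymDiffInFst-irrefl (false ∷ x) = minSymDiffInFst-irrefl x

minSymDiffInFst-asym : ∀ {n} (x y : Sub n) → minSymDiffInFst x y ≡ true → minSymDiffInFst y x ≡ false
minSymDiffInFst-asym [] [] ()
minSymDiffInFst-asym (true ∷ x) (true ∷ y) e = minSymDiffInFst-asym x y e
minSymDiffInFst-asym (true ∷ x) (false ∷ y) e = refl
minSymDiffInFst-asym (false ∷ x) (false ∷ y) e = minSymDiffInFst-asym x y e

minSymDiffInFst-meetsPrefix : ∀ {n} q (x y : Sub n) → meetsPrefix q x ≡ true → meetsPrefix q y ≡ false →
                              minSymDiffInFst x y ≡ true
minSymDiffInFst-meetsPrefix (suc q) (true ∷ x) (false ∷ y) mx my = refl
minSymDiffInFst-meetsPrefix (suc q) (false ∷ x) (false ∷ y) mx my = minSymDiffInFst-meetsPrefix q x y mx my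

simpLt-irrefl : ∀ {n} (y : Sub n) → simpLt y y ≡ false
simpLt-irrefl y rewrite <ᵇ-false {card y} ≤-refl | minSymDiffInFst-irrefl y = ∧-zeroʳ _

simpLt-asym : ∀ {n} (x y : Sub n) → simpLt x y ≡ true → simpLt y x ≡ false
simpLt-asym x y x<y with ∨-true⁻¹ {card x <ᵇ card y} x<y
... | inj₁ lt rewrite <ᵇ-false {card y} (<⇒≤ (<ᵇ-true⁻¹ lt))
                    | ≡ᵇ-false {card y} (>⇒≢ (<ᵇ-true⁻¹ lt)) = refl
... | inj₂ eq with ∧-true⁻¹ {card x ≡ᵇ card y} eq
...   | c≡ , msd rewrite <ᵇ-false {card y} {card x} (≤-reflexive (≡ᵇ-true⁻¹ c≡))
                     | minSymDiffInFst-asym x y msd = ∧-zeroʳ _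

allB-++ : ∀ {A : Set} (f : A → Bool) xs ys → allB f (xs ++ ys) ≡ allB f xs ∧ allB f ys
allB-++ f [] ys = refl
allB-++ f (x ∷ xs) ys rewrite allB-++ f xs ys with f x
... | true = refl
... | false = refl

allB-map : ∀ {A B : Set} (f : B → Bool) (g : A → B) xs → allB f (map g xs) ≡ allB (f ∘ g) xs
allB-map f g [] = refl
allB-map f g (x ∷ xs) = cong (f (g x) ∧_) (allB-map f g xs)

allB-allSubsets-∷ : ∀ {n} (f : Sub (suc n) → Bool) →
  allB f (allSubsets (suc n)) ≡ allB (f ∘ (true ∷_)) (allSubsets n) ∧ allB (f ∘ (false ∷_)) (allSubsets n)
allB-allSubsets-∷ {n} f = trans (allB-++ f (map (true ∷_) (allSubsets n)) (map (false ∷_) (allSubsets n)))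
  (cong₂ _∧_ (allB-map f (true ∷_) (allSubsets n)) (allB-map f (false ∷_) (allSubsets n)))

allB-allSubsets⁺ : ∀ {n} (f : Sub n → Bool) → (∀ y → f y ≡ true) → allB f (allSubsets n) ≡ true
allB-allSubsets⁺ {zero} f all rewrite all [] = refl
allB-allSubsets⁺ {suc n} f all rewrite allB-allSubsets-∷ f | allB-allSubsets⁺ (f ∘ (true ∷_)) (all ∘ (true ∷_)) =
  allB-allSubsets⁺ (f ∘ (false ∷_)) (all ∘ (false ∷_))

allB-allSubsets⁻ : ∀ {n} (f : Sub n → Bool) → allB f (allSubsets n) ≡ true → ∀ y → f y ≡ true
allB-allSubsets⁻ {zero} f all [] = proj₁ (∧-true⁻¹ all)
allB-allSubsets⁻ {suc n} f all (b ∷ y) rewrite allB-allSubsets-∷ f with ∧-true⁻¹ all | b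
... | all-t , _ | true = allB-allSubsets⁻ (f ∘ (true ∷_)) all-t y
... | _ , all-f | false = allB-allSubsets⁻ (f ∘ (false ∷_)) all-f y

module InitialSegment {n} (A : Sub n → Bool)
                      (A-precedes : ∀ x y → A x ≡ true → A y ≡ false → simpLt x y ≡ true) where

  inI-count : ∀ y → inI (count n A) y ≡ A y
  inI-count y with A y in Ay
  ... | true = <ᵇ-true (count-mono-< before⇒A y (simpLt-irrefl y) Ay)
    where
    before⇒A : ∀ x → simpLt x y ≡ true → A x ≡ true
    before⇒A x x<y with A x in Ax
    ... | true = refl
    ... | false = ⊥-elim (true≢false x<y (simpLt-asym y x (A-precedes y x Ay Ax)))
  ... | false = <ᵇ-false (count-mono (λ x Ax → A-precedes x y Ax Ay))

  module _ (p : ℕ) where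

    inCpI-intro : ∀ y → A y ≡ false → (∀ x → A x ≡ true → symDiffCard x y ≤ p) →
                  inCpI p (count n A) y ≡ true
    inCpI-intro y Ay close rewrite inI-count y | Ay = allB-allSubsets⁺ _ near
      where
      near : ∀ x → not (inI (count n A) x) ∨ (symDiffCard x y ≤ᵇ p) ≡ true
      near x rewrite inI-count x with A x in Ax
      ... | true = ≤ᵇ-true (close x Ax)
      ... | false = refl

    inCpI-member : ∀ y → A y ≡ true → inCpI p (count n A) y ≡ false
    inCpI-member y Ay rewrite inI-count y | Ay = refl

    inCpI-far : ∀ y x → A x ≡ true → p < symDiffCard x y → inCpI p (count n A) y ≡ false
    inCpI-far y x Ax far with inCpI p (count n A) y in e
    ... | false = refl
    ... | true = ⊥-elim (true≢false (allB-allSubsets⁻ _ (proj₂ (∧-true⁻¹ e)) x) x-far)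
      where
      x-far : not (inI (count n A) x) ∨ (symDiffCard x y ≤ᵇ p) ≡ false
      x-far rewrite inI-count x | Ax = ≤ᵇ-false far

module LayeredSegment {n} (u : ℕ) (P : Sub n → Bool)
               (P-precedes : ∀ x y → P x ≡ true → P y ≡ false → minSymDiffInFst x y ≡ true) where

  A : Sub n → Bool
  A y = (card y <ᵇ suc u) ∨ ((card y ≡ᵇ suc u) ∧ P y)

  card-A : ∀ y → A y ≡ true → card y ≤ suc u
  card-A y Ay with ∨-true⁻¹ {card y <ᵇ suc u} Ay
  ... | inj₁ lt = <⇒≤ (<ᵇ-true⁻¹ lt)
  ... | inj₂ top = ≤-reflexive (≡ᵇ-true⁻¹ (proj₁ (∧-true⁻¹ top)))

  card-¬A : ∀ y → A y ≡ false → suc u ≤ card y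
  card-¬A y ¬Ay = <ᵇ-false⁻¹ (proj₁ (∨-false⁻¹ {card y <ᵇ suc u} ¬Ay))

  A-top : ∀ y → card y ≡ suc u → A y ≡ P y
  A-top y y≡1+u rewrite y≡1+u | <ᵇ-false {suc u} {suc u} ≤-refl | ≡ᵇ-true {suc u} refl = refl

  A-above : ∀ y → suc u < card y → A y ≡ false
  A-above y 1+u<y rewrite <ᵇ-false {card y} {suc u} (<⇒≤ 1+u<y) | ≡ᵇ-false {card y} {suc u} (>⇒≢ 1+u<y) = refl

  squeezed : ∀ x y → A x ≡ true → A y ≡ false → card y ≤ card x → card x ≡ suc u × card y ≡ suc u
  squeezed x y Ax ¬Ay y≤x = ≤-antisym (card-A x Ax) (≤-trans (card-¬A y ¬Ay) y≤x)
                          , ≤-antisym (≤-trans y≤x (card-A x Ax)) (card-¬A y ¬Ay)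

  A-precedes : ∀ x y → A x ≡ true → A y ≡ false → simpLt x y ≡ true
  A-precedes x y Ax ¬Ay with card x <? card y
  ... | yes x<y rewrite <ᵇ-true x<y = refl
  ... | no x≮y with squeezed x y Ax ¬Ay (≮⇒≥ x≮y)
  ...   | x≡1+u , y≡1+u rewrite <ᵇ-false (≮⇒≥ x≮y) | ≡ᵇ-true (trans x≡1+u (sym y≡1+u)) =
            P-precedes x y (trans (sym (A-top x x≡1+u)) Ax) (trans (sym (A-top y y≡1+u)) ¬Ay)

  open InitialSegment A A-precedes public

  count-A : count n A ≡ sumTo (n C_) u + count n (λ y → (card y ≡ᵇ suc u) ∧ P y)
  count-A = trans (count-∨-disjoint (λ y → card y <ᵇ suc u) (λ y → (card y ≡ᵇ suc u) ∧ P y) disjoint)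
                  (cong (_+ count n (λ y → (card y ≡ᵇ suc u) ∧ P y)) (count-card< n u))
    where
    disjoint : ∀ y → (card y <ᵇ suc u) ∧ ((card y ≡ᵇ suc u) ∧ P y) ≡ false
    disjoint y with card y <ᵇ suc u in lt
    ... | false = refl
    ... | true rewrite ≡ᵇ-false {card y} {suc u} (<⇒≢ (<ᵇ-true⁻¹ lt)) = refl

  module _ (p : ℕ) where

    inCpI-below : ∀ y → A y ≡ false → card y + suc u ≤ p → inCpI p (count n A) y ≡ true
    inCpI-below y ¬Ay small = inCpI-intro p y ¬Ay λ x Ax → begin
      symDiffCard x y  ≤⟨ symDiffCard≤card+card x y ⟩
      card x + card y  ≤⟨ +-monoˡ-≤ (card y) (card-A x Ax) ⟩
      suc u + card y   ≡⟨ +-comm (suc u) (card y) ⟩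
      card y + suc u   ≤⟨ small ⟩
      p                ∎
      where open ≤-Reasoning

    inCpI-above : ∀ y → p < n → p + 2 ≤ card y + suc u → inCpI p (count n A) y ≡ false
    inCpI-above y p<n large = inCpI-far p y x Ax far
      where
      x = pickOutside u y
      Ax : A x ≡ true
      Ax rewrite <ᵇ-true (s≤s (card-pickOutside-≤ u y)) = refl
      far : p < symDiffCard x y
      far rewrite symDiffCard-disjoint x y (interCard-pickOutside u y) with card-pickOutside u y
      ... | inj₂ fills = subst (p <_) (sym fills) p<n
      ... | inj₁ exact = subst (p <_) (trans (+-comm (card y) u) (cong (_+ card y) (sym exact))) p<y+u
        where
        p<y+u : p < card y + u
        p<y+u = ≤-pred (≤-trans (≤-reflexive (+-comm 2 p)) (≤-trans large (≤-reflexive (+-suc (card y) u))))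

    inCpI-shared : ∀ y → A y ≡ false → card y + suc u ≡ suc p → (∀ x → P x ≡ true → 1 ≤ interCard x y) →
                   inCpI p (count n A) y ≡ true
    inCpI-shared y ¬Ay layer shares = inCpI-intro p y ¬Ay close
      where
      open ≤-Reasoning
      close : ∀ x → A x ≡ true → symDiffCard x y ≤ p
      close x Ax with ∨-true⁻¹ {card x <ᵇ suc u} Ax
      ... | inj₁ low = ≤-pred (begin-strict
        symDiffCard x y  ≤⟨ symDiffCard≤card+card x y ⟩
        card x + card y  <⟨ +-monoˡ-< (card y) (<ᵇ-true⁻¹ low) ⟩
        suc u + card y   ≡⟨ trans (+-comm (suc u) (card y)) layer ⟩
        suc p            ∎)
      ... | inj₂ top = ≤-pred (≤-pred (begin
        2 + symDiffCard x y  ≤⟨ symDiffCard-shared x y (shares x (proj₂ (∧-true⁻¹ top))) ⟩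
        card x + card y      ≡⟨ cong (_+ card y) (≡ᵇ-true⁻¹ (proj₁ (∧-true⁻¹ top))) ⟩
        suc u + card y       ≡⟨ trans (+-comm (suc u) (card y)) layer ⟩
        suc p                ≤⟨ n≤1+n (suc p) ⟩
        2 + p                ∎))

    inCpI-disjoint : ∀ y x → card y + suc u ≡ suc p → card x ≡ suc u → P x ≡ true → interCard x y ≡ 0 →
                     inCpI p (count n A) y ≡ false
    inCpI-disjoint y x layer x-top Px disjoint = inCpI-far p y x (trans (A-top x x-top) Px) (≤-reflexive (sym dist))
      where
      dist : symDiffCard x y ≡ suc p
      dist = trans (symDiffCard-disjoint x y disjoint)
                   (trans (cong (_+ card y) x-top) (trans (+-comm (suc u) (card y)) layer))

    -- L is the middle layer: below it C^p(A) contains every set outside A, above it none.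
    module _ (L : ℕ) (Q : Sub n → Bool) (layer : L + suc u ≡ suc p) (1+u<L : suc u < L) (p<n : p < n)
             (middle : ∀ y → card y ≡ L → inCpI p (count n A) y ≡ Q y) where

      inCpI-layers : ∀ y → inCpI p (count n A) y ≡ ((card y <ᵇ L) ∧ not (A y)) ∨ ((card y ≡ᵇ L) ∧ Q y)
      inCpI-layers y with A y in Ay | <-cmp (card y) L
      ... | true | _ rewrite ∧-zeroʳ (card y <ᵇ L)
                           | ≡ᵇ-false {card y} {L} (<⇒≢ (≤-<-trans (card-A y Ay) 1+u<L)) =
              inCpI-member p y Ay
      ... | false | tri< y<L _ _ rewrite <ᵇ-true {card y} {L} y<L =
              inCpI-below y Ay (≤-pred (≤-trans (+-monoˡ-≤ (suc u) y<L) (≤-reflexive layer)))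
      ... | false | tri≈ _ y≡L _ rewrite <ᵇ-false {card y} {L} (≤-reflexive (sym y≡L))
                                       | ≡ᵇ-true {card y} {L} y≡L =
              middle y y≡L
      ... | false | tri> _ _ L<y rewrite <ᵇ-false {card y} {L} (<⇒≤ L<y)
                                       | ≡ᵇ-false {card y} {L} (>⇒≢ L<y) =
              inCpI-above y p<n (≤-trans (≤-reflexive (trans (+-comm p 2) (cong suc (sym layer))))
                                           (+-monoˡ-≤ (suc u) L<y))

      cardCpI-layers : cardCpI n p (count n A) + count n A
                       ≡ count n (λ y → card y <ᵇ L) + count n (λ y → (card y ≡ᵇ L) ∧ Q y)
      cardCpI-layers = begin
        cardCpI n p (count n A) + count n A
          ≡⟨ cong (_+ count n A) (trans (count-cong inCpI-layers) (count-∨-disjoint Below Middle disjoint)) ⟩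
        (count n Below + count n Middle) + count n A
          ≡⟨ rearrange (count n Below) (count n Middle) (count n A) ⟩
        (count n A + count n Below) + count n Middle
          ≡⟨ cong (_+ count n Middle) (sym below-L) ⟩
        count n (λ y → card y <ᵇ L) + count n Middle
          ∎
        where
        open ≡-Reasoning
        Below Middle : Sub n → Bool
        Below y = (card y <ᵇ L) ∧ not (A y)
        Middle y = (card y ≡ᵇ L) ∧ Q y

        disjoint : ∀ y → Below y ∧ Middle y ≡ false
        disjoint y with card y <? L
        ... | yes y<L rewrite ≡ᵇ-false {card y} {L} (<⇒≢ y<L) = ∧-zeroʳ _
        ... | no y≮L rewrite <ᵇ-false {card y} {L} (≮⇒≥ y≮L) = refl

        A-below : ∀ y → (card y <ᵇ L) ∧ A y ≡ A y
        A-below y with A y in Ay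
        ... | true = trans (∧-identityʳ _) (<ᵇ-true (≤-<-trans (card-A y Ay) 1+u<L))
        ... | false = ∧-zeroʳ _

        below-L : count n (λ y → card y <ᵇ L) ≡ count n A + count n Below
        below-L = trans (count-split (λ y → card y <ᵇ L) A) (cong (_+ count n Below) (count-cong A-below))

        rearrange : ∀ b m a → (b + m) + a ≡ (a + b) + m
        rearrange = solve-∀

-- The two parities

cardCpI-complete : ∀ {n p a r s h} → a + s ≡ r → cardCpI n p a + a ≡ h + s →
                   cardCpI n p (r ∸ s) + r ≡ h + 2 * s
cardCpI-complete {n} {p} {a} {s = s} {h} refl core = begin
  cardCpI n p (a + s ∸ s) + (a + s)  ≡⟨ cong (λ b → cardCpI n p b + (a + s)) (m+n∸n≡m a s) ⟩
  cardCpI n p a + (a + s)            ≡⟨ sym (+-assoc (cardCpI n p a) a s) ⟩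
  (cardCpI n p a + a) + s            ≡⟨ cong (_+ s) core ⟩
  (h + s) + s                        ≡⟨ regroup h s ⟩
  h + 2 * s                          ∎
  where
  open ≡-Reasoning
  regroup : ∀ h s → (h + s) + s ≡ h + 2 * s
  regroup = solve-∀

module OddCase (q e k : ℕ) (q+1+e≡1+k : q + suc e ≡ suc k) (1≤q : 1 ≤ q) where

  p n : ℕ
  p = k + suc e
  n = q + p

  open LayeredSegment {n} e (meetsPrefix q) (minSymDiffInFst-meetsPrefix q)

  1+e<1+k : suc e < suc k
  1+e<1+k = ≤-trans (+-monoˡ-≤ (suc e) 1≤q) (≤-reflexive q+1+e≡1+k)

  layer : ∀ (y : Sub n) → card y ≡ suc k → card y + suc e ≡ suc p
  layer y y≡1+k = cong (_+ suc e) y≡1+k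

  middle : ∀ y → card y ≡ suc k → inCpI p (count n A) y ≡ containsPrefix q y
  middle y y≡1+k with containsPrefix q y in contains
  ... | true = inCpI-shared p y (A-above y (subst (suc e <_) (sym y≡1+k) 1+e<1+k)) (layer y y≡1+k)
                 (λ x meets → interCard-prefix q x y meets contains)
  ... | false = inCpI-disjoint p y x (layer y y≡1+k) x≡1+e
                  (meetsPrefix-pickOutside q e y contains) (interCard-pickOutside (suc e) y)
    where
    x = pickOutside (suc e) y
    x≡1+e : card x ≡ suc e
    x≡1+e = card-pickOutside-room (suc e) y
              (≤-trans (≤-reflexive (trans (cong (suc e +_) y≡1+k) (swap e k))) (+-monoˡ-≤ p 1≤q))
      where
      swap : ∀ e k → suc e + suc k ≡ 1 + (k + suc e)
      swap = solve-∀

  cardCpI+count-A : cardCpI n p (count n A) + count n A ≡ count n (λ y → card y <ᵇ suc k) + p C suc e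
  cardCpI+count-A = trans (cardCpI-layers p (suc k) (containsPrefix q) refl 1+e<1+k (+-monoˡ-≤ p 1≤q) middle)
                       (cong (count n (λ y → card y <ᵇ suc k) +_) containing)
    where
    containing : count n (λ y → (card y ≡ᵇ suc k) ∧ containsPrefix q y) ≡ p C suc e
    containing = subst (λ L → count n (λ y → (card y ≡ᵇ L) ∧ containsPrefix q y) ≡ p C suc e)
                       q+1+e≡1+k (count-containingPrefix q p (suc e))

  count-A+s : count n A + p C suc e ≡ sumTo (n C_) (suc e)
  count-A+s = begin
    count n A + p C suc e               ≡⟨ cong (_+ p C suc e) count-A ⟩
    (sumTo (n C_) e + B) + p C suc e    ≡⟨ +-assoc (sumTo (n C_) e) B (p C suc e) ⟩
    sumTo (n C_) e + (B + p C suc e)    ≡⟨ cong (sumTo (n C_) e +_) (count-meetingPrefix q p (suc e)) ⟩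
    sumTo (n C_) (suc e)                ∎
    where
    open ≡-Reasoning
    B = count n (λ y → (card y ≡ᵇ suc e) ∧ meetsPrefix q y)

  cardCpI-odd : cardCpI n p (sumTo (n C_) (suc e) ∸ p C suc e) + sumTo (n C_) (suc e)
                ≡ count n (λ y → card y <ᵇ suc k) + 2 * (p C suc e)
  cardCpI-odd = cardCpI-complete {n} {p} count-A+s cardCpI+count-A

module EvenCase (q e j : ℕ) (q+1+e≡1+j : q + suc e ≡ suc j) (2≤q : 2 ≤ q) where

  m M p n : ℕ
  m = j + suc e
  M = q + m
  p = suc m
  n = suc M

  P : Sub n → Bool
  P (b ∷ y) = b ∧ meetsPrefix q y

  P-precedes : ∀ x y → P x ≡ true → P y ≡ false → minSymDiffInFst x y ≡ true
  P-precedes (true ∷ x) (true ∷ y) meets avoids = minSymDiffInFst-meetsPrefix q x y meets avoids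
  P-precedes (true ∷ x) (false ∷ y) _ _ = refl

  open LayeredSegment {n} (suc e) P P-precedes

  Q : Sub n → Bool
  Q (b ∷ y) = b ∨ containsPrefix q y

  1≤q : 1 ≤ q
  1≤q = ≤-trans (s≤s z≤n) 2≤q

  2+e<1+j : suc (suc e) < suc j
  2+e<1+j = ≤-trans (+-monoˡ-≤ (suc e) 2≤q) (≤-reflexive q+1+e≡1+j)

  layer : ∀ (y : Sub n) → card y ≡ suc j → card y + suc (suc e) ≡ suc p
  layer y y≡1+j = trans (cong (_+ suc (suc e)) y≡1+j) (cong suc (+-suc j (suc e)))

  middle : ∀ y → card y ≡ suc j → inCpI p (count n A) y ≡ Q y
  middle y y≡1+j with A-above y (subst (suc (suc e) <_) (sym y≡1+j) 2+e<1+j)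
  middle (true ∷ y) y≡1+j | ¬Ay = inCpI-shared p (true ∷ y) ¬Ay (layer (true ∷ y) y≡1+j) shares
    where
    shares : ∀ x → P x ≡ true → 1 ≤ interCard x (true ∷ y)
    shares (true ∷ x) _ = s≤s z≤n
  middle (false ∷ y) y≡1+j | ¬Ay with containsPrefix q y in contains
  ... | true = inCpI-shared p (false ∷ y) ¬Ay (layer (false ∷ y) y≡1+j) shares
    where
    shares : ∀ x → P x ≡ true → 1 ≤ interCard x (false ∷ y)
    shares (true ∷ x) meets = interCard-prefix q x y meets contains
  ... | false = inCpI-disjoint p (false ∷ y) (true ∷ x) (layer (false ∷ y) y≡1+j) (cong suc x≡1+e)
                  (meetsPrefix-pickOutside q e y contains) (interCard-pickOutside (suc e) y)
    where
    x = pickOutside (suc e) y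
    x≡1+e : card x ≡ suc e
    x≡1+e = card-pickOutside-room (suc e) y
              (≤-trans (≤-reflexive (trans (cong (suc e +_) y≡1+j) (swap e j))) (+-monoˡ-≤ m 1≤q))
      where
      swap : ∀ e j → suc e + suc j ≡ 1 + (j + suc e)
      swap = solve-∀

  cardCpI+count-A : cardCpI n p (count n A) + count n A ≡ (count n (λ y → card y <ᵇ suc j) + M C j) + m C suc e
  cardCpI+count-A = begin
    cardCpI n p (count n A) + count n A
      ≡⟨ cardCpI-layers p (suc j) Q layer′ 2+e<1+j (s≤s (+-monoˡ-≤ m 1≤q)) middle ⟩
    count n (λ y → card y <ᵇ suc j) + count n (λ y → (card y ≡ᵇ suc j) ∧ Q y)
      ≡⟨ cong (count n (λ y → card y <ᵇ suc j) +_) middle-count ⟩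
    count n (λ y → card y <ᵇ suc j) + (M C j + m C suc e)
      ≡⟨ sym (+-assoc _ (M C j) (m C suc e)) ⟩
    (count n (λ y → card y <ᵇ suc j) + M C j) + m C suc e ∎
    where
    open ≡-Reasoning
    layer′ : suc j + suc (suc e) ≡ suc p
    layer′ = cong suc (+-suc j (suc e))
    middle-count : count n (λ y → (card y ≡ᵇ suc j) ∧ Q y) ≡ M C j + m C suc e
    middle-count = trans (count-∷ (λ y → (card y ≡ᵇ suc j) ∧ Q y))
      (cong₂ _+_ (trans (count-cong {M} (λ y → ∧-identityʳ (card y ≡ᵇ j))) (count-card≡ M j))
                 (subst (λ L → count M (λ y → (card y ≡ᵇ L) ∧ containsPrefix q y) ≡ m C suc e)
                        q+1+e≡1+j (count-containingPrefix q m (suc e))))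

  count-A+s : count n A + m C suc e ≡ sumTo (n C_) (suc e) + M C suc e
  count-A+s = begin
    count n A + m C suc e                         ≡⟨ cong (_+ m C suc e) count-A ⟩
    (sumTo (n C_) (suc e) + top) + m C suc e      ≡⟨ +-assoc (sumTo (n C_) (suc e)) top (m C suc e) ⟩
    sumTo (n C_) (suc e) + (top + m C suc e)      ≡⟨ cong (λ t → sumTo (n C_) (suc e) + (t + m C suc e)) top≡B ⟩
    sumTo (n C_) (suc e) + (B + m C suc e)        ≡⟨ cong (sumTo (n C_) (suc e) +_) (count-meetingPrefix q m (suc e)) ⟩
    sumTo (n C_) (suc e) + M C suc e              ∎
    where
    open ≡-Reasoning
    top = count n (λ y → (card y ≡ᵇ suc (suc e)) ∧ P y)
    B = count M (λ y → (card y ≡ᵇ suc e) ∧ meetsPrefix q y)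
    top≡B : top ≡ B
    top≡B = trans (count-∷ (λ y → (card y ≡ᵇ suc (suc e)) ∧ P y))
                  (trans (cong (B +_) (count-none {M} (λ y → ∧-zeroʳ _))) (+-identityʳ B))

  cardCpI-even : cardCpI n p ((sumTo (n C_) (suc e) + M C suc e) ∸ m C suc e) + (sumTo (n C_) (suc e) + M C suc e)
                 ≡ (count n (λ y → card y <ᵇ suc j) + M C j) + 2 * (m C suc e)
  cardCpI-even = cardCpI-complete {n} {p} count-A+s cardCpI+count-A

excesses : ∀ {k p n} → k + 1 ≤ p → p + 2 ≤ n → ∃₂ λ e q → p ≡ k + suc e × n ≡ q + p × 2 ≤ q
excesses {k} {p} {n} k+1≤p p+2≤n =
    p ∸ suc k , n ∸ p
  , trans (sym (m+[n∸m]≡n (subst (_≤ p) (+-comm k 1) k+1≤p))) (sym (+-suc k (p ∸ suc k)))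
  , sym (m∸n+n≡m (m+n≤o⇒m≤o p p+2≤n))
  , m+n≤o⇒m≤o∸n 2 (subst (_≤ n) (+-comm p 2) p+2≤n)

cardCpI-initialSegment-odd :
  (n k p : ℕ) → n ≡ 2 * k + 1 → k + 1 ≤ p → p + 2 ≤ n →
    let r = sumTo (λ i → n C i) (p ∸ k)
        s = p C (p ∸ k)
    in cardCpI n p (r ∸ s) + r ≡ 2 ^ (n ∸ 1) + 2 * s
cardCpI-initialSegment-odd n k p n≡2k+1 k+1≤p p+2≤n with excesses k+1≤p p+2≤n
... | e , q , refl , refl , 2≤q rewrite m+n∸m≡n k (suc e) =
  trans (OddCase.cardCpI-odd q e k q+1+e≡1+k (≤-trans (s≤s z≤n) 2≤q))
        (cong (_+ 2 * ((k + suc e) C suc e)) (count-lowerHalf-odd k (trans n≡2k+1 (odd-form k))))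
  where
  odd-form : ∀ k → 2 * k + 1 ≡ suc (k + k)
  odd-form = solve-∀
  regroup : ∀ q k e → q + (k + suc e) ≡ k + (q + suc e)
  regroup = solve-∀
  q+1+e≡1+k : q + suc e ≡ suc k
  q+1+e≡1+k = +-cancelˡ-≡ k _ _
    (trans (sym (regroup q k e)) (trans n≡2k+1 (trans (odd-form k) (sym (+-suc k k)))))

cardCpI-initialSegment-even :
  (n k p : ℕ) → n ≡ 2 * k → k + 1 ≤ p → p + 2 ≤ n →
    let r′ = sumTo (λ i → n C i) (p ∸ k) + (n ∸ 1) C (p ∸ k)
        s′ = (p ∸ 1) C (p ∸ k)
    in cardCpI n p (r′ ∸ s′) + r′ ≡ 2 ^ (n ∸ 1) + 2 * s′
cardCpI-initialSegment-even n zero p refl k+1≤p p+2≤n with () ← m+n≤o⇒n≤o p p+2≤n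
cardCpI-initialSegment-even n (suc j) p n≡2k k+1≤p p+2≤n with excesses {suc j} k+1≤p p+2≤n
... | e , q , refl , refl , 2≤q rewrite +-suc q (j + suc e) | m+n∸m≡n j (suc e) =
  trans (EvenCase.cardCpI-even q e j q+1+e≡1+j 2≤q)
        (cong (_+ 2 * ((j + suc e) C suc e)) (count-lowerHalf-even j M≡j+1+j))
  where
  regroup : ∀ q j e → suc (q + (j + suc e)) ≡ suc j + (q + suc e)
  regroup = solve-∀
  even-form : ∀ j → 2 * suc j ≡ suc j + suc j
  even-form = solve-∀
  swap : ∀ q j e → q + (j + e) ≡ j + (q + e)
  swap = solve-∀
  q+1+e≡1+j : q + suc e ≡ suc j
  q+1+e≡1+j = +-cancelˡ-≡ (suc j) _ _ (trans (sym (regroup q j e)) (trans n≡2k (even-form j)))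
  M≡j+1+j : q + (j + suc e) ≡ j + suc j
  M≡j+1+j = trans (swap q j (suc e)) (cong (j +_) q+1+e≡1+j)

theorem3p5 :
  -- (i) n = 2k+1 odd, (n+1)/2 = k+1 ≤ p ≤ n-2, p - (n-1)/2 = p ∸ k
  ((n k p : ℕ) → n ≡ 2 * k + 1 → k + 1 ≤ p → p + 2 ≤ n →
    let r = sumTo (λ i → n C i) (p ∸ k)
        s = p C (p ∸ k)
    in cardCpI n p (r ∸ s) + r ≡ 2 ^ (n ∸ 1) + 2 * s)
  ×
  -- (ii) n = 2k even, n/2 + 1 = k+1 ≤ p ≤ n-2, p - n/2 = p ∸ k
  ((n k p : ℕ) → n ≡ 2 * k → k + 1 ≤ p → p + 2 ≤ n →
    let r′ = sumTo (λ i → n C i) (p ∸ k) + (n ∸ 1) C (p ∸ k)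
        s′ = (p ∸ 1) C (p ∸ k)
    in cardCpI n p (r′ ∸ s′) + r′ ≡ 2 ^ (n ∸ 1) + 2 * s′)
theorem3p5 = cardCpI-initialSegment-odd , cardCpI-initialSegment-even
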